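{- Suppose all items in the input sequence have size at most $1/d$ for a real $d\ge 2$. Then Worst Fit is absolutely $(1+d/(d-1))$-competitive for Black and White Bin Packing, i.e., it uses at most $(1+d/(d-1))\cdot\mathrm{OPT}(L)$ bins on every such input $L$.
   Context: Black and White Bin Packing: items arrive as a sequence; each item has a size in $[0,1]$ and a color that is either black or white. A packing places items into unit-capacity bins, items in a bin ordered by arrival; it is valid if each bin has total size at most $1$ and no two consecutive items in a bin have the same color. $\mathrm{OPT}(L)$ is the minimum number of bins in a valid packing of $L$ without reordering. Worst Fit is the online algorithm that packs each incoming item into a bin of lowest current level (total size of its items) among the bins into which the item can be validly added, and opens a new bin only if there is no such bin.
   Formalization: The parameter d and the item sizes are rational rather than real. -}

module Defs where

open import Data.Bool using (Bool; true; false)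
open import Data.Nat as ℕ using (ℕ; zero; suc)
open import Data.Fin as Fin using (Fin; zero; suc; toℕ)
open import Data.List using (List; []; _∷_; length; lookup; updateAt; _++_; [_])
open import Data.Product using (Σ; ∃; _×_; _,_)
open import Data.Rational as ℚ using (ℚ; 0ℚ; 1ℚ; _+_; _-_; _*_; _÷_; _≤_; _<_; NonZero; Positive)
import Data.Rational.Properties as ℚP
open import Relation.Binary.PropositionalEquality using (_≡_; _≢_; refl; sym; subst)
open import Relation.Nullary using (¬_)

data Color : Set where
  black white : Color

record Item : Set where
  constructor item
  field
    size  : ℚ
    color : Color
open Item public

Input : Set
Input = List Item

WellSized : Item → Set
WellSized x = (0ℚ ≤ size x) × (size x ≤ 1ℚ)

-- every item has size in [0,1] and at most 1/d  (stated as size * d ≤ 1, d > 0)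
data AllSmall (d : ℚ) : Input → Set where
  []  : AllSmall d []
  _∷_ : ∀ {x L} → WellSized x × (size x * d ≤ 1ℚ) → AllSmall d L → AllSmall d (x ∷ L)

-- Arbitrary (offline) packings, used to define OPT.
-- A packing of L = (x_0,...,x_{n-1}) into k bins is an assignment
-- f : Fin n → Fin k; items inside a bin are ordered by arrival (index).

sumFin : (n : ℕ) → (Fin n → ℚ) → ℚ
sumFin zero    g = 0ℚ
sumFin (suc n) g = g zero + sumFin n (λ i → g (suc i))

module _ (L : Input) {k : ℕ} (f : Fin (length L) → Fin k) where

  contrib : Fin k → Fin (length L) → ℚ
  contrib b i with toℕ (f i) ℕ.≟ toℕ b
  ... | Relation.Nullary.yes _ = size (lookup L i)
  ... | Relation.Nullary.no  _ = 0ℚ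

  binLevel : Fin k → ℚ
  binLevel b = sumFin (length L) (contrib b)

  Consecutive : Fin (length L) → Fin (length L) → Set
  Consecutive i j = (i Fin.< j) × (f i ≡ f j)
                  × (∀ m → i Fin.< m → m Fin.< j → f m ≢ f j)

  ValidPacking : Set
  ValidPacking = (∀ b → binLevel b ≤ 1ℚ)
               × (∀ i j → Consecutive i j → color (lookup L i) ≢ color (lookup L j))

-- L can be validly packed into k bins (OPT(L) is the least such k)
PackableIn : Input → ℕ → Set
PackableIn L k = Σ (Fin (length L) → Fin k) (ValidPacking L)

-- A bin's state is its level and the colour of its last
-- item (every opened bin is non-empty). Ties among lowest-level feasible bins
-- may be broken arbitrarily, so Worst Fit is modelled as a relation.

record BinState : Set where
  constructor bin
  field
    level : ℚ
    last  : Color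
open BinState public

Fits : Item → BinState → Set
Fits x B = (level B + size x ≤ 1ℚ) × (last B ≢ color x)

addItem : Item → BinState → BinState
addItem x B = bin (level B + size x) (color x)

data WFStep (bs : List BinState) (x : Item) : List BinState → Set where
  into : (i : Fin (length bs)) → Fits x (lookup bs i)
       → (∀ j → Fits x (lookup bs j) → level (lookup bs i) ≤ level (lookup bs j))
       → WFStep bs x (updateAt bs i (addItem x))
  new  : (∀ j → ¬ Fits x (lookup bs j))
       → WFStep bs x (bs ++ [ bin (size x) (color x) ])

data WFRun : List BinState → Input → List BinState → Set where
  done : ∀ {bs} → WFRun bs [] bs
  step : ∀ {bs bs' bs'' x L} → WFStep bs x bs' → WFRun bs' L bs'' → WFRun bs (x ∷ L) bs''

WorstFit : Input → ℕ → Set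
WorstFit L m = Σ (List BinState) λ bs → WFRun [] L bs × (length bs ≡ m)

2ℚ : ℚ
2ℚ = 1ℚ + 1ℚ

d-1-pos : (d : ℚ) → 2ℚ ≤ d → Positive (d - 1ℚ)
d-1-pos d 2≤d = ℚ.positive 0<d-1
  where
  1<d : 1ℚ < d
  1<d = ℚP.<-≤-trans {1ℚ} {2ℚ} {d} (ℚP.+-monoʳ-< 1ℚ {0ℚ} {1ℚ} (ℚP.positive⁻¹ 1ℚ)) 2≤d
  0<d-1 : 0ℚ < d - 1ℚ
  0<d-1 = subst (_< d - 1ℚ) (ℚP.+-inverseʳ 1ℚ) (ℚP.+-monoˡ-< (ℚ.- 1ℚ) 1<d)

wfRatio : (d : ℚ) → 2ℚ ≤ d → ℚ
wfRatio d 2≤d = 1ℚ + (d ÷ (d - 1ℚ)) {{ℚP.pos⇒nonZero (d - 1ℚ) {{d-1-pos d 2≤d}}}}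

{-# OPTIONS --safe #-}
-- Call a Worst Fit bin heavy if its level exceeds (d-1)/d and light otherwise. The levels add
-- up to the total size, which is at most OPT, so there are at most d/(d-1)·OPT heavy bins.
-- For the light bins, replay an optimal packing alongside Worst Fit and keep the invariant:
-- for each colour c, the light Worst Fit bins ending in c are at most as many as the optimal
-- bins ending in c. An item of the other colour either goes into a light c-bin, or certifies
-- that every c-bin is heavy: a c-bin where it fits is at least as full as the bin Worst Fit
-- chose, and one where it overflows has level > 1 - 1/d. Meanwhile the optimal packing loses
-- at most one c-bin. Hence there are at most OPT light bins.
module Submission where

open import Defs
open import Data.Nat using (ℕ)
open import Data.Integer using (+_)
open import Data.Rational using (ℚ; _≤_; _*_; _/_)

open import Algebra.Bundles using (CommutativeMonoid)
import Algebra.Properties.CommutativeMonoid.Sum as Sum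
import Algebra.Properties.CommutativeSemigroup as CommSemigroupProperties
open import Data.Fin as Fin using (Fin; zero; suc)
open import Data.Fin.Properties using (toℕ-injective; punchInᵢ≢i)
import Data.Integer as ℤ
import Data.Integer.Properties as ℤP
open import Data.Integer.Tactic.RingSolver using (solve-∀)
open import Data.List using (List; []; _∷_; length; lookup; updateAt; _++_; [_]; map)
open import Data.List.Properties using (map-++)
open import Data.List.Relation.Unary.All using (All; []; _∷_)
open import Data.List.Relation.Unary.All.Properties using (++⁺)
open import Data.Maybe using (Maybe; just; nothing)
import Data.Maybe.Properties as Maybe
open import Data.Nat as ℕ using (zero; suc; pred; z≤n; s≤s)
import Data.Nat.Properties as ℕP
open import Data.Nat.ListAction using (sum)
open import Data.Nat.ListAction.Properties using (sum-++)
open import Data.Product using (Σ; _×_; _,_; proj₁; proj₂)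
open import Data.Rational as ℚ using (0ℚ; 1ℚ; 1/_; _+_; _-_; _÷_; _<_; Positive; NonNegative; NonZero)
import Data.Rational.Properties as ℚP
open import Data.Rational.Solver using (module +-*-Solver)
import Data.Rational.Unnormalised as ℚᵘ
import Data.Rational.Unnormalised.Properties as ℚᵘP
import Data.Vec.Functional as Vector
open import Data.Vec.Functional using (Vector)
open import Data.Vec.Functional.Properties using (updateAt-updates; updateAt-minimal)
open import Function using (_∘_; const; id; case_of_)
open import Relation.Binary.Definitions using (DecidableEquality)
open import Relation.Binary.PropositionalEquality using (_≡_; _≢_; refl; sym; trans; cong; cong₂; subst; module ≡-Reasoning)
open import Relation.Nullary using (Dec; yes; no; ¬_; contradiction)
open import Relation.Nullary.Decidable using (_×-dec_; ¬?)

module ℕΣ = Sum ℕP.+-0-commutativeMonoid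
module ℚΣ = Sum ℚP.+-0-commutativeMonoid
module ℕ+ = CommSemigroupProperties ℕP.+-commutativeSemigroup
module ℚ+ = CommSemigroupProperties (CommutativeMonoid.commutativeSemigroup ℚP.+-0-commutativeMonoid)
open ℚΣ using (sum-syntax)

fromℕ : ℕ → ℚ
fromℕ n = + n / 1

-- fromℕ n is definitionally fromℚᵘ (mkℚᵘ (+ n) 0), so the sum can be computed in ℚᵘ.
fromℕ-+ : ∀ m n → fromℕ (m ℕ.+ n) ≡ fromℕ m + fromℕ n
fromℕ-+ m n = ℚP.toℚᵘ-injective (begin
  ℚ.toℚᵘ (fromℕ (m ℕ.+ n))                 ≈⟨ ℚP.toℚᵘ-fromℚᵘ (ℚᵘ.mkℚᵘ (+ (m ℕ.+ n)) 0) ⟩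
  ℚᵘ.mkℚᵘ (+ (m ℕ.+ n)) 0                  ≈⟨ ℚᵘ.*≡* (trans (cong (ℤ._* + 1) (ℤP.pos-+ m n)) (+-over-1 (+ m) (+ n))) ⟩
  ℚᵘ.mkℚᵘ (+ m) 0 ℚᵘ.+ ℚᵘ.mkℚᵘ (+ n) 0     ≈⟨ ℚᵘP.+-cong (ℚP.toℚᵘ-fromℚᵘ (ℚᵘ.mkℚᵘ (+ m) 0)) (ℚP.toℚᵘ-fromℚᵘ (ℚᵘ.mkℚᵘ (+ n) 0)) ⟨
  ℚ.toℚᵘ (fromℕ m) ℚᵘ.+ ℚ.toℚᵘ (fromℕ n)   ≈⟨ ℚP.toℚᵘ-homo-+ (fromℕ m) (fromℕ n) ⟨
  ℚ.toℚᵘ (fromℕ m + fromℕ n)               ∎)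
  where
  open ℚᵘP.≃-Reasoning
  +-over-1 : ∀ a b → (a ℤ.+ b) ℤ.* + 1 ≡ (a ℤ.* + 1 ℤ.+ b ℤ.* + 1) ℤ.* + 1
  +-over-1 = solve-∀

fromℕ-nonNeg : ∀ n → 0ℚ ≤ fromℕ n
fromℕ-nonNeg n = ℚP.nonNegative⁻¹ (fromℕ n) {{ℚP.normalize-nonNeg n 1}}

fromℕ-mono-≤ : ∀ {m n} → m ℕ.≤ n → fromℕ m ≤ fromℕ n
fromℕ-mono-≤ {m} {n} m≤n = begin
  fromℕ m                       ≡⟨ ℚP.+-identityʳ (fromℕ m) ⟨
  fromℕ m + 0ℚ                  ≤⟨ ℚP.+-monoʳ-≤ (fromℕ m) (fromℕ-nonNeg (n ℕ.∸ m)) ⟩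
  fromℕ m + fromℕ (n ℕ.∸ m)     ≡⟨ fromℕ-+ m (n ℕ.∸ m) ⟨
  fromℕ (m ℕ.+ (n ℕ.∸ m))       ≡⟨ cong fromℕ (ℕP.m+[n∸m]≡n m≤n) ⟩
  fromℕ n                       ∎
  where open ℚP.≤-Reasoning

sum-map-updateAt : ∀ {A : Set} (w : A → ℕ) (xs : List A) i (g : A → A) →
                   w (lookup xs i) ℕ.+ sum (map w (updateAt xs i g)) ≡ w (g (lookup xs i)) ℕ.+ sum (map w xs)
sum-map-updateAt w (x ∷ xs) zero    g = ℕ+.x∙yz≈y∙xz (w x) (w (g x)) (sum (map w xs))
sum-map-updateAt w (x ∷ xs) (suc i) g = begin
  w xᵢ ℕ.+ (w x ℕ.+ sum (map w (updateAt xs i g)))   ≡⟨ ℕ+.x∙yz≈y∙xz (w xᵢ) (w x) _ ⟩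
  w x ℕ.+ (w xᵢ ℕ.+ sum (map w (updateAt xs i g)))   ≡⟨ cong (w x ℕ.+_) (sum-map-updateAt w xs i g) ⟩
  w x ℕ.+ (w (g xᵢ) ℕ.+ sum (map w xs))              ≡⟨ ℕ+.x∙yz≈y∙xz (w x) (w (g xᵢ)) _ ⟩
  w (g xᵢ) ℕ.+ (w x ℕ.+ sum (map w xs))              ∎
  where
  open ≡-Reasoning
  xᵢ = lookup xs i

sum-map-∷ʳ : ∀ {A : Set} (w : A → ℕ) (xs : List A) x → sum (map w (xs ++ [ x ])) ≡ sum (map w xs) ℕ.+ w x
sum-map-∷ʳ w xs x = begin
  sum (map w (xs ++ [ x ]))           ≡⟨ cong sum (map-++ w xs [ x ]) ⟩
  sum (map w xs ++ [ w x ])           ≡⟨ sum-++ (map w xs) [ w x ] ⟩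
  sum (map w xs) ℕ.+ (w x ℕ.+ 0)      ≡⟨ cong (sum (map w xs) ℕ.+_) (ℕP.+-identityʳ (w x)) ⟩
  sum (map w xs) ℕ.+ w x              ∎
  where open ≡-Reasoning

∑-updateAt : ∀ {A : Set} {n} (w : A → ℕ) (xs : Vector A n) j (g : A → A) →
             w (xs j) ℕ.+ ℕΣ.sum (w ∘ Vector.updateAt xs j g) ≡ w (g (xs j)) ℕ.+ ℕΣ.sum (w ∘ xs)
∑-updateAt w xs zero    g = ℕ+.x∙yz≈y∙xz (w (xs zero)) (w (g (xs zero))) _
∑-updateAt w xs (suc j) g = begin
  w xⱼ ℕ.+ (w x₀ ℕ.+ ℕΣ.sum (w ∘ Vector.updateAt (Vector.tail xs) j g))   ≡⟨ ℕ+.x∙yz≈y∙xz (w xⱼ) (w x₀) _ ⟩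
  w x₀ ℕ.+ (w xⱼ ℕ.+ ℕΣ.sum (w ∘ Vector.updateAt (Vector.tail xs) j g))   ≡⟨ cong (w x₀ ℕ.+_) (∑-updateAt w (Vector.tail xs) j g) ⟩
  w x₀ ℕ.+ (w (g xⱼ) ℕ.+ ℕΣ.sum (w ∘ Vector.tail xs))                     ≡⟨ ℕ+.x∙yz≈y∙xz (w x₀) (w (g xⱼ)) _ ⟩
  w (g xⱼ) ℕ.+ (w x₀ ℕ.+ ℕΣ.sum (w ∘ Vector.tail xs))                     ∎
  where
  open ≡-Reasoning
  x₀ = xs zero
  xⱼ = xs (suc j)

∑-indicator : ∀ {n} (j : Fin n) (g : Vector ℚ n) → (∀ i → i ≢ j → g i ≡ 0ℚ) → ∑[ i < n ] g i ≡ g j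
∑-indicator {suc n} j g g≡0 = begin
  ∑[ i < suc n ] g i                  ≡⟨ ℚΣ.sum-remove g ⟩
  g j + ℚΣ.sum (Vector.removeAt g j)  ≡⟨ cong (_+_ (g j)) (ℚΣ.sum-cong-≗ (λ i → g≡0 _ (punchInᵢ≢i j i))) ⟩
  g j + ℚΣ.sum (Vector.replicate n 0ℚ) ≡⟨ cong (_+_ (g j)) (ℚΣ.sum-replicate-zero n) ⟩
  g j + 0ℚ                            ≡⟨ ℚP.+-identityʳ (g j) ⟩
  g j                                 ∎
  where open ≡-Reasoning

∑≤n : ∀ {n} (g : Vector ℚ n) → (∀ i → g i ≤ 1ℚ) → ∑[ i < n ] g i ≤ fromℕ n
∑≤n {zero}  g g≤1 = ℚP.≤-refl
∑≤n {suc n} g g≤1 = subst (ℚΣ.sum g ≤_) (sym (fromℕ-+ 1 n))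
  (ℚP.+-mono-≤ (g≤1 zero) (∑≤n (g ∘ suc) (g≤1 ∘ suc)))

sumFin≡∑ : ∀ n (g : Fin n → ℚ) → sumFin n g ≡ ∑[ i < n ] g i
sumFin≡∑ zero    g = refl
sumFin≡∑ (suc n) g = cong (_+_ (g zero)) (sumFin≡∑ n (g ∘ suc))

𝟙 : {P : Set} → Dec P → ℕ
𝟙 (yes _) = 1
𝟙 (no _)  = 0

𝟙-yes : ∀ {P : Set} (P? : Dec P) → P → 𝟙 P? ≡ 1
𝟙-yes (yes _) _ = refl
𝟙-yes (no ¬p) p = contradiction p ¬p

𝟙-no : ∀ {P : Set} (P? : Dec P) → ¬ P → 𝟙 P? ≡ 0
𝟙-no (yes p) ¬p = contradiction p ¬p
𝟙-no (no _)  _  = refl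

𝟙≤1 : ∀ {P : Set} (P? : Dec P) → 𝟙 P? ℕ.≤ 1
𝟙≤1 (yes _) = ℕP.≤-refl
𝟙≤1 (no _)  = z≤n

_≟ᶜ_ : DecidableEquality Color
black ≟ᶜ black = yes refl
black ≟ᶜ white = no λ ()
white ≟ᶜ black = no λ ()
white ≟ᶜ white = yes refl

≢-≢⇒≡ : ∀ {a b c : Color} → a ≢ c → b ≢ c → a ≡ b
≢-≢⇒≡ {black} {black}         _   _   = refl
≢-≢⇒≡ {white} {white}         _   _   = refl
≢-≢⇒≡ {black} {white} {black} a≢c _   = contradiction refl a≢c
≢-≢⇒≡ {black} {white} {white} _   b≢c = contradiction refl b≢c
≢-≢⇒≡ {white} {black} {black} _   b≢c = contradiction refl b≢c
≢-≢⇒≡ {white} {black} {white} a≢c _   = contradiction refl a≢c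

totalSize : Input → ℚ
totalSize L = ∑[ i < length L ] size (lookup L i)

module _ (L : Input) {k : ℕ} (f : Fin (length L) → Fin k) where

  contrib-self : ∀ i → contrib L f (f i) i ≡ size (lookup L i)
  contrib-self i with Fin.toℕ (f i) ℕ.≟ Fin.toℕ (f i)
  ... | yes _   = refl
  ... | no f≢f = contradiction refl f≢f

  contrib-other : ∀ i b → b ≢ f i → contrib L f b i ≡ 0ℚ
  contrib-other i b b≢fi with Fin.toℕ (f i) ℕ.≟ Fin.toℕ b
  ... | yes fi≡b = contradiction (sym (toℕ-injective fi≡b)) b≢fi
  ... | no _     = refl

  ∑-binLevel : ∑[ b < k ] binLevel L f b ≡ totalSize L
  ∑-binLevel = begin
    ∑[ b < k ] sumFin n (λ i → contrib L f b i)   ≡⟨ ℚΣ.sum-cong-≗ (λ b → sumFin≡∑ n (contrib L f b)) ⟩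
    ∑[ b < k ] ∑[ i < n ] contrib L f b i         ≡⟨ ℚΣ.∑-comm (contrib L f) ⟩
    ∑[ i < n ] ∑[ b < k ] contrib L f b i         ≡⟨ ℚΣ.sum-cong-≗ (λ i → ∑-indicator (f i) (λ b → contrib L f b i) (contrib-other i)) ⟩
    ∑[ i < n ] contrib L f (f i) i                ≡⟨ ℚΣ.sum-cong-≗ contrib-self ⟩
    totalSize L                                   ∎
    where
    open ≡-Reasoning
    n = length L

totalSize≤bins : ∀ L k → PackableIn L k → totalSize L ≤ fromℕ k
totalSize≤bins L k (f , fits , _) =
  subst (_≤ fromℕ k) (∑-binLevel L f) (∑≤n (binLevel L f) fits)

levelSum : List BinState → ℚ
levelSum []       = 0ℚ
levelSum (B ∷ bs) = level B + levelSum bs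

levelSum-updateAt : ∀ bs i x → levelSum (updateAt bs i (addItem x)) ≡ levelSum bs + size x
levelSum-updateAt (B ∷ bs) zero    x = ℚ+.xy∙z≈xz∙y (level B) (size x) (levelSum bs)
levelSum-updateAt (B ∷ bs) (suc i) x =
  trans (cong (_+_ (level B)) (levelSum-updateAt bs i x)) (sym (ℚP.+-assoc (level B) _ _))

levelSum-∷ʳ : ∀ bs B → levelSum (bs ++ [ B ]) ≡ levelSum bs + level B
levelSum-∷ʳ []        B = trans (ℚP.+-identityʳ (level B)) (sym (ℚP.+-identityˡ (level B)))
levelSum-∷ʳ (B′ ∷ bs) B =
  trans (cong (_+_ (level B′)) (levelSum-∷ʳ bs B)) (sym (ℚP.+-assoc (level B′) _ _))

levelSum-step : ∀ {bs x bs′} → WFStep bs x bs′ → levelSum bs′ ≡ levelSum bs + size x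
levelSum-step {bs} {x} (into i _ _) = levelSum-updateAt bs i x
levelSum-step {bs} {x} (new _)      = levelSum-∷ʳ bs (bin (size x) (color x))

levelSum-run : ∀ {bs L bs′} → WFRun bs L bs′ → levelSum bs′ ≡ levelSum bs + totalSize L
levelSum-run {bs} done = sym (ℚP.+-identityʳ (levelSum bs))
levelSum-run {bs} {x ∷ L} {bs″} (step {bs' = bs′} s run) = begin
  levelSum bs″                          ≡⟨ levelSum-run run ⟩
  levelSum bs′ + totalSize L            ≡⟨ cong (_+ totalSize L) (levelSum-step s) ⟩
  levelSum bs + size x + totalSize L    ≡⟨ ℚP.+-assoc (levelSum bs) (size x) (totalSize L) ⟩
  levelSum bs + totalSize (x ∷ L)       ∎
  where open ≡-Reasoning

NonNegLevels : List BinState → Set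
NonNegLevels = All (λ B → 0ℚ ≤ level B)

All-updateAt : ∀ {A : Set} {P : A → Set} (xs : List A) i {g : A → A} →
               (∀ {y} → P y → P (g y)) → All P xs → All P (updateAt xs i g)
All-updateAt (x ∷ xs) zero    g⁺ (px ∷ pxs) = g⁺ px ∷ pxs
All-updateAt (x ∷ xs) (suc i) g⁺ (px ∷ pxs) = px ∷ All-updateAt xs i g⁺ pxs

nonNegLevels-step : ∀ {bs x bs′} → 0ℚ ≤ size x → WFStep bs x bs′ → NonNegLevels bs → NonNegLevels bs′
nonNegLevels-step {bs} 0≤s (into i _ _) = All-updateAt bs i (λ 0≤ℓ → ℚP.+-mono-≤ 0≤ℓ 0≤s)
nonNegLevels-step      0≤s (new _)      = λ nonNeg → ++⁺ nonNeg (0≤s ∷ [])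

nonNegLevels-run : ∀ {d bs L bs′} → AllSmall d L → WFRun bs L bs′ → NonNegLevels bs → NonNegLevels bs′
nonNegLevels-run []                       done         = id
nonNegLevels-run (((0≤s , _) , _) ∷ small) (step s run) = nonNegLevels-run small run ∘ nonNegLevels-step 0≤s s

-- The last colour in each bin of an optimal packing of a prefix; nothing for a bin still empty.
OptState : ℕ → Set
OptState k = Vector (Maybe Color) k

place : ∀ {k} → OptState k → Fin k → Color → OptState k
place st j c = Vector.updateAt st j (const (just c))

_≟ᵐ_ : DecidableEquality (Maybe Color)
_≟ᵐ_ = Maybe.≡-dec _≟ᶜ_

lastCount : ∀ {k} → Color → OptState k → ℕ
lastCount c st = ℕΣ.sum (λ j → 𝟙 (st j ≟ᵐ just c))

lastCount-place-same : ∀ {k} (st : OptState k) j c → st j ≢ just c →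
                       lastCount c (place st j c) ≡ suc (lastCount c st)
lastCount-place-same st j c stⱼ≢c = begin
  lastCount c (place st j c)                           ≡⟨ cong (ℕ._+ lastCount c (place st j c)) (𝟙-no (st j ≟ᵐ just c) stⱼ≢c) ⟨
  𝟙 (st j ≟ᵐ just c) ℕ.+ lastCount c (place st j c)   ≡⟨ ∑-updateAt (λ m → 𝟙 (m ≟ᵐ just c)) st j (const (just c)) ⟩
  𝟙 (just c ≟ᵐ just c) ℕ.+ lastCount c st             ≡⟨ cong (ℕ._+ lastCount c st) (𝟙-yes (just c ≟ᵐ just c) refl) ⟩
  suc (lastCount c st)                                 ∎
  where open ≡-Reasoning

lastCount-place-other : ∀ {k} (st : OptState k) j {c c′} → c′ ≢ c →
                        pred (lastCount c′ st) ℕ.≤ lastCount c′ (place st j c)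
lastCount-place-other st j {c} {c′} c′≢c = begin
  pred (lastCount c′ st)                                       ≡⟨ cong pred replaced ⟨
  pred (𝟙 (st j ≟ᵐ just c′) ℕ.+ lastCount c′ (place st j c))   ≤⟨ ℕP.pred-mono-≤ (ℕP.+-monoˡ-≤ _ (𝟙≤1 (st j ≟ᵐ just c′))) ⟩
  lastCount c′ (place st j c)                                  ∎
  where
  open ℕP.≤-Reasoning
  replaced : 𝟙 (st j ≟ᵐ just c′) ℕ.+ lastCount c′ (place st j c) ≡ lastCount c′ st
  replaced = trans (∑-updateAt (λ m → 𝟙 (m ≟ᵐ just c′)) st j (const (just c)))
                   (cong (ℕ._+ lastCount c′ st) (𝟙-no (just c ≟ᵐ just c′) (c′≢c ∘ sym ∘ Maybe.just-injective)))

lastCount-black+white≤ : ∀ {k} (st : OptState k) → lastCount black st ℕ.+ lastCount white st ℕ.≤ k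
lastCount-black+white≤ {zero}  st = z≤n
lastCount-black+white≤ {suc k} st = begin
  (b₀ ℕ.+ lastCount black st′) ℕ.+ (w₀ ℕ.+ lastCount white st′)   ≡⟨ ℕ+.interchange b₀ _ w₀ _ ⟩
  (b₀ ℕ.+ w₀) ℕ.+ (lastCount black st′ ℕ.+ lastCount white st′)   ≤⟨ ℕP.+-mono-≤ (atMostOne (st zero)) (lastCount-black+white≤ st′) ⟩
  suc k                                                            ∎
  where
  open ℕP.≤-Reasoning
  st′ = Vector.tail st
  b₀ = 𝟙 (st zero ≟ᵐ just black)
  w₀ = 𝟙 (st zero ≟ᵐ just white)
  atMostOne : ∀ m → 𝟙 (m ≟ᵐ just black) ℕ.+ 𝟙 (m ≟ᵐ just white) ℕ.≤ 1
  atMostOne nothing      = z≤n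
  atMostOne (just black) = ℕP.≤-refl
  atMostOne (just white) = ℕP.≤-refl

FirstInBin : ∀ {n k} → (Fin n → Fin k) → Fin n → Set
FirstInBin f i = ∀ m → m Fin.< i → f m ≢ f i

-- The colour constraints on a packing f of the remaining items L, starting from the bins st
-- (capacities are accounted for once and for all by totalSize≤bins).
record ValidFrom {k} (st : OptState k) (L : Input) (f : Fin (length L) → Fin k) : Set where
  field
    alternating      : ∀ i j → Consecutive L f i j → color (lookup L i) ≢ color (lookup L j)
    first-alternates : ∀ i → FirstInBin f i → st (f i) ≢ just (color (lookup L i))
open ValidFrom

validFrom-start : ∀ {L k} {f : Fin (length L) → Fin k} → ValidPacking L f → ValidFrom (const nothing) L f
validFrom-start (_ , alternates) = record { alternating = alternates ; first-alternates = λ _ _ () }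

validFrom-head : ∀ {k x L} {st : OptState k} {f} → ValidFrom st (x ∷ L) f → st (f zero) ≢ just (color x)
validFrom-head v = first-alternates v zero (λ _ ())

module _ {k : ℕ} {x : Item} {L : Input} {f : Fin (length (x ∷ L)) → Fin k} where

  Consecutive-suc : ∀ {i j} → Consecutive L (f ∘ suc) i j → Consecutive (x ∷ L) f (suc i) (suc j)
  Consecutive-suc (i<j , same , apart) = s≤s i<j , same , λ where
    zero    ()        _
    (suc m) (s≤s i<m) (s≤s m<j) → apart m i<m m<j

  Consecutive-zero : ∀ {i} → f zero ≡ f (suc i) → FirstInBin (f ∘ suc) i → Consecutive (x ∷ L) f zero (suc i)
  Consecutive-zero same first = s≤s z≤n , same , λ where
    zero    ()  _
    (suc m) _   (s≤s m<i) → first m m<i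

  FirstInBin-suc : ∀ {i} → f zero ≢ f (suc i) → FirstInBin (f ∘ suc) i → FirstInBin f (suc i)
  FirstInBin-suc f₀≢ first zero    _         = f₀≢
  FirstInBin-suc f₀≢ first (suc m) (s≤s m<i) = first m m<i

  validFrom-tail : ∀ {st : OptState k} → ValidFrom st (x ∷ L) f → ValidFrom (place st (f zero) (color x)) L (f ∘ suc)
  validFrom-tail {st} v = record
    { alternating      = λ i j → alternating v (suc i) (suc j) ∘ Consecutive-suc
    ; first-alternates = first-alternates′
    }
    where
    first-alternates′ : ∀ i → FirstInBin (f ∘ suc) i → place st (f zero) (color x) (f (suc i)) ≢ just (color (lookup L i))
    first-alternates′ i first with f (suc i) Fin.≟ f zero
    ... | yes same = λ placed≡ → alternating v zero (suc i) (Consecutive-zero (sym same) first)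
                                   (Maybe.just-injective (trans (sym placed) placed≡))
      where
      placed : place st (f zero) (color x) (f (suc i)) ≡ just (color x)
      placed = trans (cong (place st (f zero) (color x)) same) (updateAt-updates (f zero) st)
    ... | no differ = subst (_≢ just (color (lookup L i))) (sym (updateAt-minimal (f (suc i)) (f zero) st differ))
                            (first-alternates v (suc i) (FirstInBin-suc (differ ∘ sym) first))

module _ (d : ℚ) .{{_ : Positive d}} where

  private instance
    d-nonNeg : NonNegative d
    d-nonNeg = ℚP.pos⇒nonNeg d

  -- level > 1 - 1/d, multiplied by d
  Heavy : ℚ → Set
  Heavy ℓ = d - 1ℚ < ℓ * d

  Heavy? : ∀ ℓ → Dec (Heavy ℓ)
  Heavy? ℓ = d - 1ℚ ℚP.<? ℓ * d

  Heavy-mono : ∀ {ℓ ℓ′} → ℓ ≤ ℓ′ → Heavy ℓ → Heavy ℓ′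
  Heavy-mono ℓ≤ℓ′ heavy = ℚP.<-≤-trans heavy (ℚP.*-monoʳ-≤-nonNeg d ℓ≤ℓ′)

  overflow⇒Heavy : ∀ {ℓ s} → s * d ≤ 1ℚ → 1ℚ < ℓ + s → Heavy ℓ
  overflow⇒Heavy {ℓ} {s} sd≤1 1<ℓ+s = begin-strict
    d - 1ℚ               <⟨ ℚP.+-monoˡ-< (ℚ.- 1ℚ) d<ℓd+1 ⟩
    ℓ * d + 1ℚ - 1ℚ      ≡⟨ solve 2 (λ ℓ d → ℓ :* d :+ con 1ℚ :- con 1ℚ := ℓ :* d) refl ℓ d ⟩
    ℓ * d                ∎
    where
    open ℚP.≤-Reasoning
    open +-*-Solver
    d<ℓd+1 : d < ℓ * d + 1ℚ
    d<ℓd+1 = begin-strict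
      d                 ≡⟨ ℚP.*-identityˡ d ⟨
      1ℚ * d            <⟨ ℚP.*-monoˡ-<-pos d 1<ℓ+s ⟩
      (ℓ + s) * d       ≡⟨ ℚP.*-distribʳ-+ d ℓ s ⟩
      ℓ * d + s * d     ≤⟨ ℚP.+-monoʳ-≤ (ℓ * d) sd≤1 ⟩
      ℓ * d + 1ℚ        ∎

  Light : Color → BinState → Set
  Light c B = last B ≡ c × ¬ Heavy (level B)

  Light? : ∀ c B → Dec (Light c B)
  Light? c B = (last B ≟ᶜ c) ×-dec ¬? (Heavy? (level B))

  lightCount : Color → List BinState → ℕ
  lightCount c bs = sum (map (λ B → 𝟙 (Light? c B)) bs)

  heavyCount : List BinState → ℕ
  heavyCount bs = sum (map (λ B → 𝟙 (Heavy? (level B))) bs)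

  light-or-heavy : ∀ B → 1 ℕ.≤ 𝟙 (Light? black B) ℕ.+ 𝟙 (Light? white B) ℕ.+ 𝟙 (Heavy? (level B))
  light-or-heavy (bin ℓ c) = case Heavy? ℓ of λ where
      (yes heavy) → ℕP.≤-trans (ℕP.≤-reflexive (sym (𝟙-yes (Heavy? ℓ) heavy))) (ℕP.m≤n+m _ _)
      (no light)  → ℕP.≤-trans (light-in c light) (ℕP.m≤m+n _ _)
    where
    light-in : ∀ c → ¬ Heavy ℓ → 1 ℕ.≤ 𝟙 (Light? black (bin ℓ c)) ℕ.+ 𝟙 (Light? white (bin ℓ c))
    light-in black light = ℕP.≤-trans (ℕP.≤-reflexive (sym (𝟙-yes (Light? black (bin ℓ black)) (refl , light)))) (ℕP.m≤m+n _ _)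
    light-in white light = ℕP.≤-trans (ℕP.≤-reflexive (sym (𝟙-yes (Light? white (bin ℓ white)) (refl , light)))) (ℕP.m≤n+m _ _)

  length≤lightCounts+heavyCount : ∀ bs → length bs ℕ.≤ lightCount black bs ℕ.+ lightCount white bs ℕ.+ heavyCount bs
  length≤lightCounts+heavyCount []       = z≤n
  length≤lightCounts+heavyCount (B ∷ bs) = begin
    suc (length bs)                                                    ≤⟨ ℕP.+-mono-≤ (light-or-heavy B) (length≤lightCounts+heavyCount bs) ⟩
    (b ℕ.+ w ℕ.+ h) ℕ.+ (lightCount black bs ℕ.+ lightCount white bs ℕ.+ heavyCount bs)
      ≡⟨ ℕ+.interchange (b ℕ.+ w) h _ (heavyCount bs) ⟩
    (b ℕ.+ w ℕ.+ (lightCount black bs ℕ.+ lightCount white bs)) ℕ.+ (h ℕ.+ heavyCount bs)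
      ≡⟨ cong (ℕ._+ (h ℕ.+ heavyCount bs)) (ℕ+.interchange b w (lightCount black bs) (lightCount white bs)) ⟩
    lightCount black (B ∷ bs) ℕ.+ lightCount white (B ∷ bs) ℕ.+ heavyCount (B ∷ bs)   ∎
    where
    open ℕP.≤-Reasoning
    b = 𝟙 (Light? black B)
    w = 𝟙 (Light? white B)
    h = 𝟙 (Heavy? (level B))

  heavy-indicator-bound : ∀ ℓ → 0ℚ ≤ ℓ → fromℕ (𝟙 (Heavy? ℓ)) * (d - 1ℚ) ≤ d * ℓ
  heavy-indicator-bound ℓ 0≤ℓ with Heavy? ℓ
  ... | yes heavy = begin
    1ℚ * (d - 1ℚ)   ≡⟨ ℚP.*-identityˡ (d - 1ℚ) ⟩
    d - 1ℚ          ≤⟨ ℚP.<⇒≤ heavy ⟩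
    ℓ * d           ≡⟨ ℚP.*-comm ℓ d ⟩
    d * ℓ           ∎
    where open ℚP.≤-Reasoning
  ... | no _      = begin
    0ℚ * (d - 1ℚ)   ≡⟨ ℚP.*-zeroˡ (d - 1ℚ) ⟩
    0ℚ              ≡⟨ ℚP.*-zeroʳ d ⟨
    d * 0ℚ          ≤⟨ ℚP.*-monoˡ-≤-nonNeg d 0≤ℓ ⟩
    d * ℓ           ∎
    where open ℚP.≤-Reasoning

  heavyCount-bound : ∀ bs → NonNegLevels bs → fromℕ (heavyCount bs) * (d - 1ℚ) ≤ d * levelSum bs
  heavyCount-bound []       []            = ℚP.≤-reflexive (trans (ℚP.*-zeroˡ (d - 1ℚ)) (sym (ℚP.*-zeroʳ d)))
  heavyCount-bound (B ∷ bs) (0≤ℓ ∷ nonNeg) = begin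
    fromℕ (h ℕ.+ heavyCount bs) * (d - 1ℚ)                      ≡⟨ cong (_* (d - 1ℚ)) (fromℕ-+ h (heavyCount bs)) ⟩
    (fromℕ h + fromℕ (heavyCount bs)) * (d - 1ℚ)                ≡⟨ ℚP.*-distribʳ-+ (d - 1ℚ) (fromℕ h) _ ⟩
    fromℕ h * (d - 1ℚ) + fromℕ (heavyCount bs) * (d - 1ℚ)       ≤⟨ ℚP.+-mono-≤ (heavy-indicator-bound (level B) 0≤ℓ) (heavyCount-bound bs nonNeg) ⟩
    d * level B + d * levelSum bs                               ≡⟨ ℚP.*-distribˡ-+ d (level B) (levelSum bs) ⟨
    d * levelSum (B ∷ bs)                                       ∎
    where
    open ℚP.≤-Reasoning
    h = 𝟙 (Heavy? (level B))

  lightCount≡0 : ∀ c bs → (∀ j → last (lookup bs j) ≡ c → Heavy (level (lookup bs j))) → lightCount c bs ≡ 0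
  lightCount≡0 c []       _     = refl
  lightCount≡0 c (B ∷ bs) heavy =
    cong₂ ℕ._+_ (𝟙-no (Light? c B) (λ (ends-c , light) → light (heavy zero ends-c))) (lightCount≡0 c bs (heavy ∘ suc))

  feasible-heavy⇒lightCount≡0 : ∀ {x} c bs → size x * d ≤ 1ℚ → c ≢ color x →
                                (∀ j → Fits x (lookup bs j) → Heavy (level (lookup bs j))) → lightCount c bs ≡ 0
  feasible-heavy⇒lightCount≡0 {x} c bs small c≢x feasible⇒heavy = lightCount≡0 c bs ends-c⇒heavy
    where
    ends-c⇒heavy : ∀ j → last (lookup bs j) ≡ c → Heavy (level (lookup bs j))
    ends-c⇒heavy j ends-c with level (lookup bs j) + size x ℚP.≤? 1ℚ
    ... | yes room    = feasible⇒heavy j (room , c≢x ∘ trans (sym ends-c))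
    ... | no overflow = overflow⇒Heavy {level (lookup bs j)} {size x} small (ℚP.≰⇒> overflow)

  lightCount-step-same : ∀ {bs x bs′} → WFStep bs x bs′ → lightCount (color x) bs′ ℕ.≤ suc (lightCount (color x) bs)
  lightCount-step-same {bs} {x} (into i _ _) = begin
    lightCount c (updateAt bs i (addItem x))                      ≤⟨ ℕP.m≤n+m _ (𝟙 (Light? c B)) ⟩
    𝟙 (Light? c B) ℕ.+ lightCount c (updateAt bs i (addItem x))   ≡⟨ sum-map-updateAt (λ B → 𝟙 (Light? c B)) bs i (addItem x) ⟩
    𝟙 (Light? c (addItem x B)) ℕ.+ lightCount c bs                ≤⟨ ℕP.+-monoˡ-≤ _ (𝟙≤1 (Light? c (addItem x B))) ⟩
    suc (lightCount c bs)                                         ∎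
    where
    open ℕP.≤-Reasoning
    c = color x
    B = lookup bs i
  lightCount-step-same {bs} {x} (new _) = begin
    lightCount c (bs ++ [ B ])           ≡⟨ sum-map-∷ʳ (λ B → 𝟙 (Light? c B)) bs B ⟩
    lightCount c bs ℕ.+ 𝟙 (Light? c B)   ≤⟨ ℕP.+-monoʳ-≤ _ (𝟙≤1 (Light? c B)) ⟩
    lightCount c bs ℕ.+ 1                ≡⟨ ℕP.+-comm _ 1 ⟩
    suc (lightCount c bs)                ∎
    where
    open ℕP.≤-Reasoning
    c = color x
    B = bin (size x) (color x)

  lightCount-updateAt-other : ∀ {x} c bs i → c ≢ color x →
    𝟙 (Light? c (lookup bs i)) ℕ.+ lightCount c (updateAt bs i (addItem x)) ≡ lightCount c bs
  lightCount-updateAt-other {x} c bs i c≢x =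
    trans (sum-map-updateAt (λ B → 𝟙 (Light? c B)) bs i (addItem x))
          (cong (ℕ._+ lightCount c bs) (𝟙-no (Light? c (addItem x (lookup bs i))) (c≢x ∘ sym ∘ proj₁)))

  -- Either the chosen bin was a light c-bin, or every c-bin is heavy.
  lightCount-step-other : ∀ {bs x bs′} c → size x * d ≤ 1ℚ → c ≢ color x → WFStep bs x bs′ →
                          lightCount c bs′ ℕ.≤ pred (lightCount c bs)
  lightCount-step-other {bs} {x} c small c≢x (into i fits lowest) with Heavy? (level (lookup bs i))
  ... | yes heavy =
    ℕP.≤-trans (ℕP.≤-reflexive (ℕP.m+n≡0⇒n≡0 _ (trans (lightCount-updateAt-other {x} c bs i c≢x) none-light))) z≤n
    where
    none-light : lightCount c bs ≡ 0
    none-light = feasible-heavy⇒lightCount≡0 c bs small c≢x (λ j fitsʲ → Heavy-mono (lowest j fitsʲ) heavy)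
  ... | no light = ℕP.≤-reflexive (cong pred (trans (cong (ℕ._+ lightCount c (updateAt bs i (addItem x))) (sym chosen-light))
                                                    (lightCount-updateAt-other {x} c bs i c≢x)))
    where
    chosen-light : 𝟙 (Light? c (lookup bs i)) ≡ 1
    chosen-light = 𝟙-yes (Light? c (lookup bs i)) (≢-≢⇒≡ (proj₂ fits) c≢x , light)
  lightCount-step-other {bs} {x} c small c≢x (new none-fits) = ℕP.≤-reflexive (begin
    lightCount c (bs ++ [ B ])           ≡⟨ sum-map-∷ʳ (λ B → 𝟙 (Light? c B)) bs B ⟩
    lightCount c bs ℕ.+ 𝟙 (Light? c B)   ≡⟨ cong₂ ℕ._+_ none-light (𝟙-no (Light? c B) (c≢x ∘ sym ∘ proj₁)) ⟩
    0                                    ≡⟨ cong pred none-light ⟨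
    pred (lightCount c bs)               ∎)
    where
    open ≡-Reasoning
    B = bin (size x) (color x)
    none-light : lightCount c bs ≡ 0
    none-light = feasible-heavy⇒lightCount≡0 c bs small c≢x (λ j fitsʲ → contradiction fitsʲ (none-fits j))

  LightDominated : ∀ {k} → List BinState → OptState k → Set
  LightDominated bs st = ∀ c → lightCount c bs ℕ.≤ lastCount c st

  dominated-step : ∀ {k bs x bs′} {st : OptState k} j → size x * d ≤ 1ℚ → st j ≢ just (color x) →
                   WFStep bs x bs′ → LightDominated bs st → LightDominated bs′ (place st j (color x))
  dominated-step {x = x} {st = st} j small fresh s dom c with c ≟ᶜ color x
  ... | yes refl = ℕP.≤-trans (lightCount-step-same s)
                     (ℕP.≤-trans (s≤s (dom c)) (ℕP.≤-reflexive (sym (lastCount-place-same st j c fresh))))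
  ... | no c≢x   = ℕP.≤-trans (lightCount-step-other c small c≢x s)
                     (ℕP.≤-trans (ℕP.pred-mono-≤ (dom c)) (lastCount-place-other st j c≢x))

  dominated-run : ∀ {k bs L bs′} {st : OptState k} {f} → ValidFrom st L f → AllSmall d L →
                  WFRun bs L bs′ → LightDominated bs st → Σ (OptState k) (LightDominated bs′)
  dominated-run _ [] done dom = _ , dom
  dominated-run {f = f} v ((_ , small) ∷ smalls) (step s run) dom =
    dominated-run (validFrom-tail v) smalls run (dominated-step (f zero) small (validFrom-head v) s dom)

ratio-bound : ∀ d (2≤d : 2ℚ ≤ d) {m k h} → m ℕ.≤ k ℕ.+ h → fromℕ h * (d - 1ℚ) ≤ d * fromℕ k →
              fromℕ m ≤ wfRatio d 2≤d * fromℕ k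
ratio-bound d 2≤d {m} {k} {h} m≤k+h h[d-1]≤dk = begin
  fromℕ m                      ≤⟨ fromℕ-mono-≤ m≤k+h ⟩
  fromℕ (k ℕ.+ h)              ≡⟨ fromℕ-+ k h ⟩
  fromℕ k + fromℕ h            ≤⟨ ℚP.+-monoʳ-≤ (fromℕ k) h≤rk ⟩
  fromℕ k + r * fromℕ k        ≡⟨ cong (_+ r * fromℕ k) (ℚP.*-identityˡ (fromℕ k)) ⟨
  1ℚ * fromℕ k + r * fromℕ k   ≡⟨ ℚP.*-distribʳ-+ (fromℕ k) 1ℚ r ⟨
  (1ℚ + r) * fromℕ k           ∎
  where
  open ℚP.≤-Reasoning
  instance
    d-1>0 : Positive (d - 1ℚ)
    d-1>0 = d-1-pos d 2≤d
    d-1≢0 : NonZero (d - 1ℚ)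
    d-1≢0 = ℚP.pos⇒nonZero (d - 1ℚ)
  r = d ÷ (d - 1ℚ)
  h≤rk : fromℕ h ≤ r * fromℕ k
  h≤rk = ℚP.*-cancelʳ-≤-pos (d - 1ℚ) (begin
    fromℕ h * (d - 1ℚ)                          ≤⟨ h[d-1]≤dk ⟩
    d * fromℕ k                                 ≡⟨ ℚP.*-identityʳ (d * fromℕ k) ⟨
    d * fromℕ k * 1ℚ                            ≡⟨ cong (d * fromℕ k *_) (ℚP.*-inverseˡ (d - 1ℚ)) ⟨
    d * fromℕ k * (1/ (d - 1ℚ) * (d - 1ℚ))      ≡⟨ solve 4 (λ a K i e → a :* K :* (i :* e) := a :* i :* K :* e) refl d (fromℕ k) (1/ (d - 1ℚ)) (d - 1ℚ) ⟩
    r * fromℕ k * (d - 1ℚ)                      ∎)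
    where open +-*-Solver

theorem5p3 : (d : ℚ) (2≤d : 2ℚ ≤ d) (L : Input) → AllSmall d L →
    (m : ℕ) → WorstFit L m → (k : ℕ) → PackableIn L k →
    (+ m) / 1 ≤ wfRatio d 2≤d * ((+ k) / 1)
theorem5p3 d 2≤d L small _ (bs , run , refl) k packing@(_ , valid) =
  ratio-bound d 2≤d {h = heavyCount d bs} bins≤k+heavy heavy≤k
  where
  instance
    d>0 : Positive d
    d>0 = ℚ.positive (ℚP.<-≤-trans (ℚP.positive⁻¹ 2ℚ) 2≤d)
  lights≤k : lightCount d black bs ℕ.+ lightCount d white bs ℕ.≤ k
  lights≤k with dominated-run d (validFrom-start valid) small run (λ _ → z≤n)
  ... | st , dom = ℕP.≤-trans (ℕP.+-mono-≤ (dom black) (dom white)) (lastCount-black+white≤ st)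
  bins≤k+heavy : length bs ℕ.≤ k ℕ.+ heavyCount d bs
  bins≤k+heavy = ℕP.≤-trans (length≤lightCounts+heavyCount d bs) (ℕP.+-monoˡ-≤ (heavyCount d bs) lights≤k)
  heavy≤k : fromℕ (heavyCount d bs) * (d - 1ℚ) ≤ d * fromℕ k
  heavy≤k = begin
    fromℕ (heavyCount d bs) * (d - 1ℚ)   ≤⟨ heavyCount-bound d bs (nonNegLevels-run small run []) ⟩
    d * levelSum bs                      ≡⟨ cong (d *_) (trans (levelSum-run run) (ℚP.+-identityˡ (totalSize L))) ⟩
    d * totalSize L                      ≤⟨ ℚP.*-monoˡ-≤-nonNeg d (totalSize≤bins L k packing) ⟩
    d * fromℕ k                          ∎
    where
    open ℚP.≤-Reasoning
    instance
      d≥0 : NonNegative d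
      d≥0 = ℚP.pos⇒nonNeg d
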